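{- Let $G=K_{n_1,\ldots,n_k}$ and suppose $G$ has an equitable $q$-coloring. Then $p(q:n_1,\ldots,n_k)$ is the minimum $p$ such that $G$ has an equitable $r$-coloring for each integer $r$ with $p\le r\le q$. In particular, the equitable chromatic threshold of $K_{n_1,\ldots,n_k}$ equals $p(n_1+\cdots+n_k:n_1,\ldots,n_k)$.
   Context: All graphs are finite and simple. For a graph $G$ with $N=|V(G)|$ vertices, an equitable $q$-coloring of $G$ is a partition of $V(G)$ into $q$ (possibly empty) independent sets, each of size $\lfloor N/q\rfloor$ or $\lceil N/q\rceil$. The equitable chromatic threshold of $G$ is the minimum $p$ such that $G$ has an equitable $q$-coloring for every integer $q\ge p$. $K_{n_1,\ldots,n_k}$ is the complete $k$-partite graph with partite sets $X_1,\ldots,X_k$, $|X_i|=n_i$. Definition of $p$: suppose $K_{n_1,\ldots,n_k}$ has an equitable $q$-coloring. Then $p(q:n_1,\ldots,n_k)=\lceil n_1/d\rceil+\cdots+\lceil n_k/d\rceil$, where $d$ is the minimum integer with $d\ge\lceil (n_1+\cdots+n_k)/q\rceil$ satisfying at least one of: (i) there exist $i\ne j$ such that neither $n_i$ nor $n_j$ is divisible by $d$; (ii) there exists $i$ with $n_i/\lfloor n_i/d\rfloor>d+1$. -}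

module Defs where

open import Data.Nat using (ℕ; zero; suc; _+_; _*_; _∸_; _≤_; _<_; _/_; NonZero)
open import Data.Nat.Divisibility using (_∣_)
open import Data.Nat.ListAction using (sum)
open import Data.Fin using (Fin; _≟_)
open import Data.List using (List; length; filter; tabulate; allFin)
open import Data.Product using (Σ; ∃; ∃-syntax; _×_; _,_)
open import Data.Sum using (_⊎_)
open import Data.Empty using (⊥)
open import Relation.Nullary using (¬_)
open import Relation.Binary.PropositionalEquality using (_≡_; _≢_)

⌈_/_⌉ : (a b : ℕ) .{{_ : NonZero b}} → ℕ
⌈ a / b ⌉ = (a + b ∸ 1) / b

-- The complete k-partite graph K_{n_1,...,n_k}, given by n : Fin k → ℕ.
-- Vertices: pairs (i , x) with x ∈ X_i = Fin (n i).
Vertex : {k : ℕ} → (Fin k → ℕ) → Set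
Vertex {k} n = Σ (Fin k) (λ i → Fin (n i))

Adj : {k : ℕ} (n : Fin k → ℕ) → Vertex n → Vertex n → Set
Adj n (i , _) (j , _) = i ≢ j

order : {k : ℕ} → (Fin k → ℕ) → ℕ
order n = sum (tabulate n)

classSize : {k q : ℕ} (n : Fin k → ℕ) → (Vertex n → Fin q) → Fin q → ℕ
classSize {k} n c j = sum (tabulate (λ i → length (filter (λ x → c (i , x) ≟ j) (allFin (n i)))))

-- an equitable q-colouring: a map V → Fin q (i.e. a partition into q possibly
-- empty classes) whose classes are independent sets, each of size
-- ⌊N/q⌋ or ⌈N/q⌉.  There is no equitable 0-colouring (⌊N/0⌋ is meaningless).
record EquitableColoring {k : ℕ} (n : Fin k → ℕ) (q : ℕ) .{{_ : NonZero q}} : Set where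
  field
    colour      : Vertex n → Fin q
    independent : ∀ u v → Adj n u v → colour u ≢ colour v
    lower       : ∀ j → order n / q ≤ classSize n colour j
    upper       : ∀ j → classSize n colour j ≤ ⌈ order n / q ⌉

HasEqCol : {k : ℕ} (n : Fin k → ℕ) → ℕ → Set
HasEqCol n zero    = ⊥
HasEqCol n (suc q) = EquitableColoring n (suc q)

IsMinimum : (ℕ → Set) → ℕ → Set
IsMinimum P p = P p × (∀ p′ → P p′ → p ≤ p′)

IsEqThreshold : {k : ℕ} (n : Fin k → ℕ) → ℕ → Set
IsEqThreshold n = IsMinimum (λ p → ∀ r → p ≤ r → HasEqCol n r)

-- conditions (i) / (ii) on d (d = 0 never qualifies).
-- (ii) n_i / ⌊n_i/d⌋ > d+1 is written as (d+1)·⌊n_i/d⌋ < n_i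
-- (for ⌊n_i/d⌋ = 0 this reads n_i/0 = ∞ > d+1)
DCond : {k : ℕ} (n : Fin k → ℕ) → ℕ → Set
DCond n zero = ⊥
DCond n (suc e) =
  (∃[ i ] ∃[ j ] (i ≢ j × ¬ (suc e ∣ n i) × ¬ (suc e ∣ n j)))
  ⊎ (∃[ i ] (suc (suc e) * (n i / suc e) < n i))

-- ⌈N/q⌉ (q = 0 never occurs below: it is excluded by the hypotheses)
ceilNq : {k : ℕ} (n : Fin k → ℕ) → ℕ → ℕ
ceilNq n zero    = 0
ceilNq n (suc q) = ⌈ order n / suc q ⌉

IsMinD : {k : ℕ} (n : Fin k → ℕ) (q : ℕ) → ℕ → Set
IsMinD n q = IsMinimum (λ d → ceilNq n q ≤ d × DCond n d)

-- ⌈n_1/d⌉ + ... + ⌈n_k/d⌉   (junk value 0 for d = 0, which never occurs)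
pSum : {k : ℕ} (n : Fin k → ℕ) → ℕ → ℕ
pSum n zero    = 0
pSum n (suc e) = sum (tabulate (λ i → ⌈ n i / suc e ⌉))

IsP : {k : ℕ} (n : Fin k → ℕ) (q : ℕ) → ℕ → Set
IsP n q p = ∃[ d ] (IsMinD n q d × p ≡ pSum n d)

-- In a proper colouring of K_{n_1,...,n_k} each colour class lies inside one part, so an equitable
-- r-colouring is the same as cutting every part X_i into c_i blocks of size e or e + 1, where
-- e + 1 = ⌈N/r⌉ and c_1 + ... + c_k = r (conversely, colour the vertices of X_i by their residue
-- modulo c_i).  For a fixed block size e + 1 the attainable totals r form an interval from
-- ⌈n_1/(e+1)⌉ + ... + ⌈n_k/(e+1)⌉ upwards; while neither (i) nor (ii) holds at e + 1 the intervals for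
-- consecutive block sizes overlap, so everything from q down to p(q) is attainable.  At the least
-- qualifying d the total p - 1 is not: blocks of size at most d need at least p blocks, and with
-- blocks of size at least d two parts fall short of ⌈n_i/d⌉ blocks.

module Submission where

open import Defs
open import Data.Nat hiding (_≟_)
open import Data.Nat.Properties hiding (_≟_; suc-injective)
open import Data.Nat.DivMod
open import Data.Nat using () renaming (_≟_ to _≟ℕ_)
open import Data.Nat.Divisibility using (_∣_; _∣?_; divides)
import Data.Nat.ListAction as List
open import Data.Fin using (Fin; zero; suc; _≟_; toℕ; fromℕ; inject₁; _↑ˡ_; _↑ʳ_; splitAt)
open import Data.Fin.Properties using (any?; toℕ-injective; toℕ<n; toℕ-fromℕ; toℕ-fromℕ<; toℕ-inject₁; ↑ˡ-injective; ↑ʳ-injective; splitAt-↑ˡ; splitAt-↑ʳ; splitAt⁻¹-↑ˡ; splitAt⁻¹-↑ʳ; suc-injective)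
open import Data.List using (length; filter; tabulate)
open import Data.Product using (∃-syntax; _×_; _,_; proj₁; proj₂)
open import Data.Sum using (_⊎_; inj₁; inj₂; [_,_]′)
open import Data.Empty using (⊥-elim)
open import Relation.Nullary using (¬_; Dec; yes; no)
open import Relation.Nullary.Decidable using (¬?; _×-dec_; _⊎-dec_; decidable-stable)
open import Relation.Unary using (Pred; Decidable)
open import Relation.Binary.PropositionalEquality
open import Relation.Binary.Definitions using (Tri; tri<; tri≈; tri>)
open import Function using (_∘_)
open import Algebra.Properties.Semiring.Sum +-*-semiring
  using (sum; sum-cong-≗; ∑-distrib-+; ∑-comm; *-distribʳ-sum; sum-replicate-zero; sum-init-last)

indicator : ∀ {a} {P : Set a} → Dec P → ℕ
indicator (yes _) = 1
indicator (no _)  = 0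

indicator-yes : ∀ {a} {P : Set a} (P? : Dec P) → P → indicator P? ≡ 1
indicator-yes (yes _) _ = refl
indicator-yes (no ¬p) p = ⊥-elim (¬p p)

indicator-no : ∀ {a} {P : Set a} (P? : Dec P) → ¬ P → indicator P? ≡ 0
indicator-no (yes p) ¬p = ⊥-elim (¬p p)
indicator-no (no _)  _  = refl

indicator-cong : ∀ {a b} {P : Set a} {Q : Set b} → (P → Q) → (Q → P) →
                 (P? : Dec P) (Q? : Dec Q) → indicator P? ≡ indicator Q?
indicator-cong f g (yes p) Q? = sym (indicator-yes Q? (f p))
indicator-cong f g (no ¬p) Q? = sym (indicator-no Q? (¬p ∘ g))

indicator≤1 : ∀ {a} {P : Set a} (P? : Dec P) → indicator P? ≤ 1
indicator≤1 (yes _) = ≤-refl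
indicator≤1 (no _)  = z≤n

indicator-pos : ∀ {a} {P : Set a} (P? : Dec P) → 0 < indicator P? → P
indicator-pos (yes p) _ = p

sum-tabulate : ∀ {k} (f : Fin k → ℕ) → List.sum (tabulate f) ≡ sum f
sum-tabulate {zero}  f = refl
sum-tabulate {suc k} f = cong (f zero +_) (sum-tabulate (f ∘ suc))

length-filter-tabulate : ∀ {a p} {A : Set a} {P : Pred A p} (P? : Decidable P) {k} (f : Fin k → A) →
                         length (filter P? (tabulate f)) ≡ sum (λ i → indicator (P? (f i)))
length-filter-tabulate P? {zero}  f = refl
length-filter-tabulate P? {suc k} f with P? (f zero)
... | yes _ = cong suc (length-filter-tabulate P? (f ∘ suc))
... | no _  = length-filter-tabulate P? (f ∘ suc)

sum-mono-≤ : ∀ {k} {f g : Fin k → ℕ} → (∀ i → f i ≤ g i) → sum f ≤ sum g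
sum-mono-≤ {zero}  f≤g = z≤n
sum-mono-≤ {suc k} f≤g = +-mono-≤ (f≤g zero) (sum-mono-≤ (f≤g ∘ suc))

≤-sum : ∀ {k} (f : Fin k → ℕ) i → f i ≤ sum f
≤-sum f zero    = m≤m+n (f zero) _
≤-sum f (suc i) = ≤-trans (≤-sum (f ∘ suc) i) (m≤n+m _ (f zero))

sum-pos⇒∃-pos : ∀ {k} (f : Fin k → ℕ) → 0 < sum f → ∃[ i ] 0 < f i
sum-pos⇒∃-pos {suc k} f pos with f zero in eq
... | suc _ = zero , subst (0 <_) (sym eq) z<s
... | zero  = let (i , p) = sum-pos⇒∃-pos (f ∘ suc) pos in suc i , p

sum-zero : ∀ {k} {f : Fin k → ℕ} → (∀ i → f i ≡ 0) → sum f ≡ 0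
sum-zero {k} f≡0 = trans (sum-cong-≗ f≡0) (sum-replicate-zero k)

sum-indicator-none : ∀ {k p} {P : Pred (Fin k) p} (P? : Decidable P) → (∀ i → ¬ P i) →
                     sum (λ i → indicator (P? i)) ≡ 0
sum-indicator-none P? ¬P = sum-zero λ i → indicator-no (P? i) (¬P i)

sum-*ʳ : ∀ {k} (f : Fin k → ℕ) c → sum (λ i → f i * c) ≡ sum f * c
sum-*ʳ f c = sym (*-distribʳ-sum c f)

sum-ones : ∀ k → sum {k} (λ _ → 1) ≡ k
sum-ones zero    = refl
sum-ones (suc k) = cong suc (sum-ones k)

sum-supported-at : ∀ {k} (f : Fin k → ℕ) o → (∀ i → i ≢ o → f i ≡ 0) → sum f ≡ f o
sum-supported-at f zero f≡0 =
  trans (cong (f zero +_) (sum-zero λ i → f≡0 (suc i) λ ())) (+-identityʳ (f zero))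
sum-supported-at f (suc o) f≡0 =
  cong₂ _+_ (f≡0 zero λ ()) (sum-supported-at (f ∘ suc) o λ i i≢o → f≡0 (suc i) (i≢o ∘ suc-injective))

sum-δ : ∀ {k} (a : Fin k) → sum (λ j → indicator (a ≟ j)) ≡ 1
sum-δ a = trans (sum-supported-at _ a λ i i≢a → indicator-no (a ≟ i) (i≢a ∘ sym))
                (indicator-yes (a ≟ a) refl)

sum-+2≤ : ∀ {k} {f g : Fin k → ℕ} → (∀ l → f l ≤ g l) → ∀ {i j} → i ≢ j → f i < g i → f j < g j → sum f + 2 ≤ sum g
sum-+2≤ {f = f} {g} f≤g {i} {j} i≢j fᵢ<gᵢ fⱼ<gⱼ = begin
  sum f + 2                                       ≡⟨ cong (sum f +_) (cong₂ _+_ (sum-δ i) (sum-δ j)) ⟨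
  sum f + (sum (δ i) + sum (δ j))                 ≡⟨ cong (sum f +_) (∑-distrib-+ (δ i) (δ j)) ⟨
  sum f + sum (λ l → δ i l + δ j l)               ≡⟨ ∑-distrib-+ f (λ l → δ i l + δ j l) ⟨
  sum (λ l → f l + (δ i l + δ j l))               ≤⟨ sum-mono-≤ bump ⟩
  sum g                                           ∎
  where
  open ≤-Reasoning
  δ : _ → _ → ℕ
  δ a l = indicator (a ≟ l)
  bump : ∀ l → f l + (δ i l + δ j l) ≤ g l
  bump l with i ≟ l | j ≟ l
  ... | yes refl | yes refl = ⊥-elim (i≢j refl)
  ... | yes refl | no _     = subst (_≤ g l) (+-comm 1 (f l)) fᵢ<gᵢ
  ... | no _     | yes refl = subst (_≤ g l) (+-comm 1 (f l)) fⱼ<gⱼ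
  ... | no _     | no _     = subst (_≤ g l) (sym (+-identityʳ (f l))) (f≤g l)

sum-mono-≤-tight : ∀ {k} {f g : Fin k → ℕ} → (∀ i → f i ≤ g i) → sum g ≤ sum f → ∀ i → f i ≡ g i
sum-mono-≤-tight {suc k} {f} {g} f≤g ∑g≤∑f = go
  where
  head≡ : f zero ≡ g zero
  head≡ = ≤-antisym (f≤g zero)
    (+-cancelʳ-≤ _ _ _ (≤-trans (+-monoʳ-≤ (g zero) (sum-mono-≤ (f≤g ∘ suc))) ∑g≤∑f))
  tail≤ : sum (g ∘ suc) ≤ sum (f ∘ suc)
  tail≤ = +-cancelˡ-≤ (f zero) _ _ (subst (λ z → z + sum (g ∘ suc) ≤ _) (sym head≡) ∑g≤∑f)
  go : ∀ i → f i ≡ g i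
  go zero    = head≡
  go (suc i) = sum-mono-≤-tight (f≤g ∘ suc) tail≤ i

sum-toℕ-suc : ∀ m (g : ℕ → ℕ) → sum {suc m} (g ∘ toℕ) ≡ sum {m} (g ∘ toℕ) + g m
sum-toℕ-suc m g = begin
  sum {suc m} (g ∘ toℕ)                           ≡⟨ sum-init-last {m} (g ∘ toℕ) ⟩
  sum {m} (g ∘ toℕ ∘ inject₁) + g (toℕ (fromℕ m)) ≡⟨ cong₂ _+_ (sum-cong-≗ {m} (cong g ∘ toℕ-inject₁)) (cong g (toℕ-fromℕ m)) ⟩
  sum {m} (g ∘ toℕ) + g m                         ∎
  where open ≡-Reasoning

module _ {n : ℕ} .{{_ : NonZero n}} where

  m<[1+m/n]*n : ∀ m → m < suc (m / n) * n
  m<[1+m/n]*n m = begin-strict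
    m                     ≡⟨ m≡m%n+[m/n]*n m n ⟩
    m % n + (m / n) * n   <⟨ +-monoˡ-< _ (m%n<n m n) ⟩
    n + (m / n) * n       ∎
    where open ≤-Reasoning

  o*n≤m⇒o≤m/n : ∀ {m o} → o * n ≤ m → o ≤ m / n
  o*n≤m⇒o≤m/n {m} {o} o*n≤m = ≮⇒≥ λ m/n<o →
    <-irrefl refl (<-≤-trans (m<[1+m/n]*n m) (≤-trans (*-monoˡ-≤ n m/n<o) o*n≤m))

  m≤o*n⇒m/n≤o : ∀ {m o} → m ≤ o * n → m / n ≤ o
  m≤o*n⇒m/n≤o {m} {o} m≤o*n = ≤-trans (/-monoˡ-≤ n m≤o*n) (≤-reflexive (m*n/n≡m o n))

  private
    ⌈⌉-numerator : ∀ m → m + n ∸ 1 ≡ m + pred n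
    ⌈⌉-numerator m = +-∸-assoc m {n} {1} (>-nonZero⁻¹ n)

  m≤⌈m/n⌉*n : ∀ m → m ≤ ⌈ m / n ⌉ * n
  m≤⌈m/n⌉*n m = +-cancelʳ-≤ n m _ (begin
    m + n                      ≡⟨ cong (m +_) (suc-pred n) ⟨
    m + suc (pred n)           ≡⟨ +-suc m (pred n) ⟩
    suc (m + pred n)           ≡⟨ cong suc (⌈⌉-numerator m) ⟨
    suc (m + n ∸ 1)            ≤⟨ m<[1+m/n]*n (m + n ∸ 1) ⟩
    n + ⌈ m / n ⌉ * n          ≡⟨ +-comm n _ ⟩
    ⌈ m / n ⌉ * n + n          ∎)
    where open ≤-Reasoning

  m≤o*n⇒⌈m/n⌉≤o : ∀ {m o} → m ≤ o * n → ⌈ m / n ⌉ ≤ o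
  m≤o*n⇒⌈m/n⌉≤o {m} {o} m≤o*n = ≤-pred (m<n*o⇒m/o<n (begin-strict
    m + n ∸ 1                  ≡⟨ ⌈⌉-numerator m ⟩
    m + pred n                 ≤⟨ +-monoˡ-≤ (pred n) m≤o*n ⟩
    o * n + pred n             <⟨ +-monoʳ-< (o * n) (≤-reflexive (suc-pred n)) ⟩
    o * n + n                  ≡⟨ +-comm (o * n) n ⟩
    suc o * n                  ∎))
    where open ≤-Reasoning

  ⌈m/n⌉≤1+m/n : ∀ m → ⌈ m / n ⌉ ≤ suc (m / n)
  ⌈m/n⌉≤1+m/n m = m≤o*n⇒⌈m/n⌉≤o (<⇒≤ (m<[1+m/n]*n m))

  m/n≤⌈m/n⌉ : ∀ m → m / n ≤ ⌈ m / n ⌉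
  m/n≤⌈m/n⌉ m = m≤o*n⇒m/n≤o (m≤⌈m/n⌉*n m)

  n∣m⇒⌈m/n⌉≤m/n : ∀ {m} → n ∣ m → ⌈ m / n ⌉ ≤ m / n
  n∣m⇒⌈m/n⌉≤m/n n∣m = m≤o*n⇒⌈m/n⌉≤o (≤-reflexive (sym (m/n*n≡m n∣m)))

  n∤m⇒1+m/n≤⌈m/n⌉ : ∀ {m} → ¬ (n ∣ m) → suc (m / n) ≤ ⌈ m / n ⌉
  n∤m⇒1+m/n≤⌈m/n⌉ {m} n∤m = ≰⇒> λ ⌈m/n⌉≤m/n → n∤m (divides (m / n) (≤-antisym
    (≤-trans (m≤⌈m/n⌉*n m) (*-monoˡ-≤ n ⌈m/n⌉≤m/n)) (m/n*n≤m m n)))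

  o*n<m⇒o<⌈m/n⌉ : ∀ {m o} → o * n < m → o < ⌈ m / n ⌉
  o*n<m⇒o<⌈m/n⌉ {m} {o} o*n<m = ≰⇒> λ ⌈m/n⌉≤o → <⇒≱ o*n<m (≤-trans (m≤⌈m/n⌉*n m) (*-monoˡ-≤ n ⌈m/n⌉≤o))

  0<m⇒0<⌈m/n⌉ : ∀ {m} → 0 < m → 0 < ⌈ m / n ⌉
  0<m⇒0<⌈m/n⌉ {m} 0<m = ≰⇒> λ ⌈m/n⌉≤0 → <-irrefl refl (<-≤-trans 0<m (≤-trans (m≤⌈m/n⌉*n m) (*-monoˡ-≤ n ⌈m/n⌉≤0)))

-- Counting residues

residueCount : (C : ℕ) .{{_ : NonZero C}} → ℕ → ℕ → ℕ
residueCount C y m = sum {m} (λ x → indicator (toℕ x % C ≟ℕ y))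

module _ {C y : ℕ} .{{_ : NonZero C}} (y<C : y < C) where

  private
    rc = residueCount C y

  residueCount-suc : ∀ m → rc (suc m) ≡ rc m + indicator (m % C ≟ℕ y)
  residueCount-suc m = sum-toℕ-suc m (λ x → indicator (x % C ≟ℕ y))

  residueCount-below : ∀ {m} → m ≤ C → rc m ≡ indicator (y <? m)
  residueCount-below {zero}  _     = refl
  residueCount-below {suc m} m<C = begin
    rc (suc m)                                 ≡⟨ residueCount-suc m ⟩
    rc m + indicator (m % C ≟ℕ y)              ≡⟨ cong₂ _+_ (residueCount-below (<⇒≤ m<C)) (cong (λ z → indicator (z ≟ℕ y)) (m<n⇒m%n≡m m<C)) ⟩
    indicator (y <? m) + indicator (m ≟ℕ y)    ≡⟨ step (<-cmp y m) ⟩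
    indicator (y <? suc m)                     ∎
    where
    open ≡-Reasoning
    step : Tri (y < m) (y ≡ m) (m < y) → indicator (y <? m) + indicator (m ≟ℕ y) ≡ indicator (y <? suc m)
    step (tri< y<m y≢m _) =
      trans (cong₂ _+_ (indicator-yes (y <? m) y<m) (indicator-no (m ≟ℕ y) (y≢m ∘ sym)))
            (sym (indicator-yes (y <? suc m) (m<n⇒m<1+n y<m)))
    step (tri≈ _ refl _) =
      trans (cong₂ _+_ (indicator-no (y <? y) (n≮n y)) (indicator-yes (y ≟ℕ y) refl))
            (sym (indicator-yes (y <? suc y) (n<1+n y)))
    step (tri> _ y≢m m<y) =
      trans (cong₂ _+_ (indicator-no (y <? m) (<-asym m<y)) (indicator-no (m ≟ℕ y) (y≢m ∘ sym)))
            (sym (indicator-no (y <? suc m) (<⇒≱ m<y ∘ ≤-pred)))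

  residueCount-period : ∀ m → rc (C + m) ≡ suc (rc m)
  residueCount-period zero = begin
    rc (C + 0)          ≡⟨ cong rc (+-identityʳ C) ⟩
    rc C                ≡⟨ residueCount-below ≤-refl ⟩
    indicator (y <? C)  ≡⟨ indicator-yes (y <? C) y<C ⟩
    1                   ∎
    where open ≡-Reasoning
  residueCount-period (suc m) = begin
    rc (C + suc m)                                  ≡⟨ cong rc (+-suc C m) ⟩
    rc (suc (C + m))                                ≡⟨ residueCount-suc (C + m) ⟩
    rc (C + m) + indicator ((C + m) % C ≟ℕ y)       ≡⟨ cong₂ _+_ (residueCount-period m) (cong (λ z → indicator (z ≟ℕ y)) (trans (cong (_% C) (+-comm C m)) ([m+n]%n≡m%n m C))) ⟩
    suc (rc m + indicator (m % C ≟ℕ y))             ≡⟨ cong suc (residueCount-suc m) ⟨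
    suc (rc (suc m))                                ∎
    where open ≡-Reasoning

  residueCount-+-* : ∀ q b → rc (q * C + b) ≡ q + rc b
  residueCount-+-* zero    b = refl
  residueCount-+-* (suc q) b = begin
    rc (C + q * C + b)    ≡⟨ cong rc (+-assoc C (q * C) b) ⟩
    rc (C + (q * C + b))  ≡⟨ residueCount-period (q * C + b) ⟩
    suc (rc (q * C + b))  ≡⟨ cong suc (residueCount-+-* q b) ⟩
    suc (q + rc b)        ∎
    where open ≡-Reasoning

  residueCount-* : ∀ q → rc (q * C) ≡ q
  residueCount-* q = trans (cong rc (sym (+-identityʳ (q * C)))) (trans (residueCount-+-* q 0) (+-identityʳ q))

  residueCount≡quotient+δ : ∀ m → rc m ≡ m / C + indicator (y <? m % C)
  residueCount≡quotient+δ m = begin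
    rc m                               ≡⟨ cong rc (trans (m≡m%n+[m/n]*n m C) (+-comm (m % C) _)) ⟩
    rc (m / C * C + m % C)             ≡⟨ residueCount-+-* (m / C) (m % C) ⟩
    m / C + rc (m % C)                 ≡⟨ cong (m / C +_) (residueCount-below (<⇒≤ (m%n<n m C))) ⟩
    m / C + indicator (y <? m % C)     ∎
    where open ≡-Reasoning

  residueCount-bounds : ∀ {m e} → C * e ≤ m → m ≤ C * suc e → e ≤ rc m × rc m ≤ suc e
  residueCount-bounds {m} {e} lo hi = lower , upper (m≤n⇒m<n∨m≡n hi)
    where
    lower : e ≤ rc m
    lower = ≤-trans (o*n≤m⇒o≤m/n (subst (_≤ m) (*-comm C e) lo))
                    (≤-trans (m≤m+n (m / C) _) (≤-reflexive (sym (residueCount≡quotient+δ m))))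
    upper : m < C * suc e ⊎ m ≡ C * suc e → rc m ≤ suc e
    upper (inj₁ m<) = begin
      rc m                            ≡⟨ residueCount≡quotient+δ m ⟩
      m / C + indicator (y <? m % C)  ≤⟨ +-mono-≤ (≤-pred (m<n*o⇒m/o<n (subst (m <_) (*-comm C (suc e)) m<))) (indicator≤1 (y <? m % C)) ⟩
      e + 1                           ≡⟨ +-comm e 1 ⟩
      suc e                           ∎
      where open ≤-Reasoning
    upper (inj₂ refl) = ≤-reflexive (trans (cong rc (*-comm C (suc e))) (residueCount-* (suc e)))

-- Equitable colourings as block decompositions

↑ˡ≢↑ʳ : ∀ {m n} (a : Fin m) (b : Fin n) → a ↑ˡ n ≢ m ↑ʳ b
↑ˡ≢↑ʳ {m} {n} a b eq
  with () ← trans (sym (splitAt-↑ˡ m a n)) (trans (cong (splitAt m) eq) (splitAt-↑ʳ m n b))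

-- Round robin inside each part: part i has its own suc (c i) colours, and vertex x gets colour x mod suc (c i).
blockColouring : ∀ {k} (n c : Fin k → ℕ) → Vertex n → Fin (sum (λ i → suc (c i)))
blockColouring {suc k} n c (zero , x)  = (toℕ x mod suc (c zero)) ↑ˡ sum (λ i → suc (c (suc i)))
blockColouring {suc k} n c (suc i , x) = suc (c zero) ↑ʳ blockColouring (n ∘ suc) (c ∘ suc) (i , x)

blockColouring-proper : ∀ {k} (n c : Fin k → ℕ) u v → Adj n u v → blockColouring n c u ≢ blockColouring n c v
blockColouring-proper {suc k} n c (zero  , x) (zero  , y) i≢j = ⊥-elim (i≢j refl)
blockColouring-proper {suc k} n c (zero  , x) (suc j , y) i≢j = ↑ˡ≢↑ʳ _ _
blockColouring-proper {suc k} n c (suc i , x) (zero  , y) i≢j = ↑ˡ≢↑ʳ _ _ ∘ sym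
blockColouring-proper {suc k} n c (suc i , x) (suc j , y) i≢j =
  blockColouring-proper (n ∘ suc) (c ∘ suc) (i , x) (j , y) (i≢j ∘ cong suc) ∘ ↑ʳ-injective (suc (c zero)) _ _

partCount : ∀ {k r} (n : Fin k → ℕ) → (Vertex n → Fin r) → Fin r → Fin k → ℕ
partCount n col j i = sum {n i} (λ x → indicator (col (i , x) ≟ j))

classSize≡sum-partCount : ∀ {k r} (n : Fin k → ℕ) (col : Vertex n → Fin r) j →
                          classSize n col j ≡ sum (partCount n col j)
classSize≡sum-partCount {k} n col j =
  trans (sum-tabulate {k} _) (sum-cong-≗ λ i → length-filter-tabulate (λ x → col (i , x) ≟ j) (λ x → x))

blockColouring-classSize : ∀ {k} (n c : Fin k → ℕ) j → ∃[ i ] ∃[ y ] (y < suc (c i) ×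
                           sum (partCount n (blockColouring n c) j) ≡ residueCount (suc (c i)) y (n i))
blockColouring-classSize {suc k} n c j with splitAt (suc (c zero)) j in split
... | inj₁ a with refl ← splitAt⁻¹-↑ˡ {i = j} split = zero , toℕ a , toℕ<n a , (begin
  partCount n col j zero + sum (partCount n col j ∘ suc)
    ≡⟨ cong₂ _+_ (sum-cong-≗ {n zero} own-residue)
                 (sum-zero {k} λ i → sum-indicator-none (λ x → col (suc i , x) ≟ j) λ x → ↑ˡ≢↑ʳ a _ ∘ sym) ⟩
  residueCount C (toℕ a) (n zero) + 0
    ≡⟨ +-identityʳ _ ⟩
  residueCount C (toℕ a) (n zero)                        ∎)
  where
  open ≡-Reasoning
  C = suc (c zero)
  col = blockColouring n c
  own-residue : ∀ x → indicator (col (zero , x) ≟ j) ≡ indicator (toℕ x % C ≟ℕ toℕ a)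
  own-residue x = indicator-cong
    (λ eq → trans (sym (toℕ-fromℕ< _)) (cong toℕ (↑ˡ-injective _ _ _ eq)))
    (λ eq → cong (_↑ˡ _) (toℕ-injective (trans (toℕ-fromℕ< _) eq))) _ _
... | inj₂ b with refl ← splitAt⁻¹-↑ʳ {i = j} split =
  let (i , y , y<C , count) = blockColouring-classSize (n ∘ suc) (c ∘ suc) b
  in suc i , y , y<C , (begin
  partCount n col j zero + sum (partCount n col j ∘ suc)
    ≡⟨ cong₂ _+_ (sum-indicator-none (λ x → col (zero , x) ≟ j) λ x → ↑ˡ≢↑ʳ _ b)
                 (sum-cong-≗ {k} λ i → sum-cong-≗ {n (suc i)} λ x → indicator-cong (↑ʳ-injective C _ _) (cong (C ↑ʳ_)) _ _) ⟩
  sum (partCount (n ∘ suc) (blockColouring (n ∘ suc) (c ∘ suc)) b)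
    ≡⟨ count ⟩
  residueCount (suc (c (suc i))) y (n (suc i))            ∎)
  where
  open ≡-Reasoning
  C = suc (c zero)
  col = blockColouring n c

-- Splits n e c: part i can be cut into c i blocks, each of size e or e + 1.
record Splits {k} (n : Fin k → ℕ) (e : ℕ) (c : Fin k → ℕ) : Set where
  field
    lower : ∀ i → c i * e ≤ n i
    upper : ∀ i → n i ≤ c i * suc e

Splittable : ∀ {k} → (Fin k → ℕ) → ℕ → Set
Splittable n r = ∃[ e ] ∃[ c ] (Splits n e c × sum c ≡ r)

order≡sum : ∀ {k} (n : Fin k → ℕ) → order n ≡ sum n
order≡sum {k} n = sum-tabulate {k} n

module _ {k} {n : Fin k → ℕ} {e} {c : Fin k → ℕ} (split : Splits n e c) where

  splits-order-≤ : order n ≤ sum c * suc e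
  splits-order-≤ = begin
    order n                      ≡⟨ order≡sum n ⟩
    sum n                        ≤⟨ sum-mono-≤ (Splits.upper split) ⟩
    sum (λ i → c i * suc e)      ≡⟨ sum-*ʳ c (suc e) ⟩
    sum c * suc e                ∎
    where open ≤-Reasoning

  splits-order-≥ : sum c * e ≤ order n
  splits-order-≥ = begin
    sum c * e                    ≡⟨ sum-*ʳ c e ⟨
    sum (λ i → c i * e)          ≤⟨ sum-mono-≤ (Splits.lower split) ⟩
    sum n                        ≡⟨ order≡sum n ⟨
    order n                      ∎
    where open ≤-Reasoning

  splits-tight-≤ : sum c * suc e ≤ order n → ∀ i → n i ≡ c i * suc e
  splits-tight-≤ tight = sum-mono-≤-tight (Splits.upper split) (begin
    sum (λ i → c i * suc e)      ≡⟨ sum-*ʳ c (suc e) ⟩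
    sum c * suc e                ≤⟨ tight ⟩
    order n                      ≡⟨ order≡sum n ⟩
    sum n                        ∎)
    where open ≤-Reasoning

  splits-tight-≥ : order n ≤ sum c * e → ∀ i → c i * e ≡ n i
  splits-tight-≥ tight = sum-mono-≤-tight (Splits.lower split) (begin
    sum n                        ≡⟨ order≡sum n ⟨
    order n                      ≤⟨ tight ⟩
    sum c * e                    ≡⟨ sum-*ʳ c e ⟨
    sum (λ i → c i * e)          ∎)
    where open ≤-Reasoning

  -- Unless N = R (e + 1) we have ⌊N/R⌋ ≤ e; and if N = R (e + 1), every part is exactly c i (e + 1), so the class
  -- has e + 1 vertices. Dually for ⌈N/R⌉.
  splits-residueCount-equitable : ∀ {R} .{{_ : NonZero R}} → sum c ≡ R → ∀ i .{{_ : NonZero (c i)}} {y} → y < c i →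
    order n / R ≤ residueCount (c i) y (n i) × residueCount (c i) y (n i) ≤ ⌈ order n / R ⌉
  splits-residueCount-equitable {R} refl i {y} y<C = lower , upper
    where
    N = order n
    s = residueCount (c i) y (n i)
    s-bounds = residueCount-bounds y<C (Splits.lower split i) (Splits.upper split i)
    lower : N / R ≤ s
    lower with N <? R * suc e
    ... | yes N< = ≤-trans (≤-pred (m<n*o⇒m/o<n (subst (N <_) (*-comm R (suc e)) N<))) (proj₁ s-bounds)
    ... | no N≮ = begin
      N / R         ≤⟨ m≤o*n⇒m/n≤o (subst (N ≤_) (*-comm R (suc e)) splits-order-≤) ⟩
      suc e         ≡⟨ residueCount-* y<C (suc e) ⟨
      residueCount (c i) y (suc e * c i) ≡⟨ cong (residueCount (c i) y) (trans (*-comm (suc e) (c i)) (sym (splits-tight-≤ (≮⇒≥ N≮) i))) ⟩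
      s             ∎
      where open ≤-Reasoning
    upper : s ≤ ⌈ N / R ⌉
    upper with R * e <? N
    ... | yes <N = ≤-trans (proj₂ s-bounds) (≰⇒> λ ⌈N/R⌉≤e →
                     <⇒≱ <N (≤-trans (m≤⌈m/n⌉*n N) (subst (⌈ N / R ⌉ * R ≤_) (*-comm e R) (*-monoˡ-≤ R ⌈N/R⌉≤e))))
    ... | no ≮N = begin
      s             ≡⟨ cong (residueCount (c i) y) (trans (sym (splits-tight-≥ (≮⇒≥ ≮N) i)) (*-comm (c i) e)) ⟩
      residueCount (c i) y (e * c i) ≡⟨ residueCount-* y<C e ⟩
      e             ≤⟨ *-cancelʳ-≤ e _ R (≤-trans (≤-trans (≤-reflexive (*-comm e R)) splits-order-≥) (m≤⌈m/n⌉*n N)) ⟩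
      ⌈ N / R ⌉     ∎
      where open ≤-Reasoning

blockColouring-equitable : ∀ {k} {n c : Fin (suc k) → ℕ} {e} → Splits n e (λ i → suc (c i)) →
                           HasEqCol n (sum (λ i → suc (c i)))
blockColouring-equitable {n = n} {c} split = record
  { colour      = blockColouring n c
  ; independent = blockColouring-proper n c
  ; lower       = proj₁ ∘ bounds
  ; upper       = proj₂ ∘ bounds
  }
  where
  R = sum (λ i → suc (c i))
  bounds : ∀ j → order n / R ≤ classSize n (blockColouring n c) j × classSize n (blockColouring n c) j ≤ ⌈ order n / R ⌉
  bounds j with blockColouring-classSize n c j
  ... | i , y , y<C , count rewrite classSize≡sum-partCount n (blockColouring n c) j | count =
    splits-residueCount-equitable split refl i y<C

splits-blocks-pos : ∀ {k} {n : Fin k → ℕ} {e c} → Splits n e c → ∀ i → 0 < n i → 0 < c i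
splits-blocks-pos {c = c} split i 0<n with c i | Splits.upper split i
... | zero  | n≤0 = ⊥-elim (<⇒≱ 0<n n≤0)
... | suc _ | _   = z<s

splittable⇒hasEqCol : ∀ {k} {n : Fin (suc k) → ℕ} → (∀ i → 0 < n i) → ∀ {r} → Splittable n r → HasEqCol n r
splittable⇒hasEqCol {n = n} n>0 (e , c , split , refl) = subst (HasEqCol n) (sum-cong-≗ c≡) (blockColouring-equitable split′)
  where
  c≡ : ∀ i → suc (pred (c i)) ≡ c i
  c≡ i = suc-pred (c i) {{>-nonZero (splits-blocks-pos split i (n>0 i))}}
  split′ : Splits n e (λ i → suc (pred (c i)))
  split′ = record
    { lower = λ i → subst (λ b → b * e ≤ n i) (sym (c≡ i)) (Splits.lower split i)
    ; upper = λ i → subst (λ b → n i ≤ b * suc e) (sym (c≡ i)) (Splits.upper split i)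
    }

colour-owner : ∀ {k r} (n : Fin (suc k) → ℕ) (col : Vertex n → Fin r) → (∀ u v → Adj n u v → col u ≢ col v) →
               ∀ j → ∃[ o ] ∀ i → i ≢ o → partCount n col j i ≡ 0
colour-owner n col proper j with any? (λ i → 0 <? partCount n col j i)
... | no none = zero , λ i _ → n≤0⇒n≡0 (≮⇒≥ λ 0<m → none (i , 0<m))
... | yes (o , 0<mₒ) = o , λ i i≢o → n≤0⇒n≡0 (≮⇒≥ λ 0<mᵢ →
      proper (i , vertex i 0<mᵢ .proj₁) (o , vertex o 0<mₒ .proj₁) i≢o
             (trans (vertex i 0<mᵢ .proj₂) (sym (vertex o 0<mₒ .proj₂))))
  where
  vertex : ∀ i → 0 < partCount n col j i → ∃[ x ] col (i , x) ≡ j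
  vertex i 0<m = let (x , 0<δ) = sum-pos⇒∃-pos _ 0<m in x , indicator-pos (col (i , x) ≟ j) 0<δ

sum-partCount : ∀ {k r} (n : Fin k → ℕ) (col : Vertex n → Fin r) i → sum (λ j → partCount n col j i) ≡ n i
sum-partCount {r = r} n col i = begin
  sum (λ j → partCount n col j i)                              ≡⟨ ∑-comm {n i} {r} (λ x j → indicator (col (i , x) ≟ j)) ⟨
  sum {n i} (λ x → sum (λ j → indicator (col (i , x) ≟ j)))   ≡⟨ sum-cong-≗ (λ x → sum-δ (col (i , x))) ⟩
  sum {n i} (λ _ → 1)                                          ≡⟨ sum-ones (n i) ⟩
  n i                                                          ∎
  where open ≡-Reasoning

module _ {k r} {n : Fin (suc k) → ℕ} (ec : EquitableColoring n (suc r)) where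

  open EquitableColoring ec

  private
    R = suc r
    N = order n

  colourOwner : Fin R → Fin (suc k)
  colourOwner j = proj₁ (colour-owner n colour independent j)

  ownedColours : Fin (suc k) → ℕ
  ownedColours i = sum (λ j → indicator (colourOwner j ≟ i))

  sum-ownedColours : sum ownedColours ≡ R
  sum-ownedColours = begin
    sum ownedColours                                   ≡⟨ ∑-comm {suc k} {R} (λ i j → indicator (colourOwner j ≟ i)) ⟩
    sum (λ j → sum (λ i → indicator (colourOwner j ≟ i)))  ≡⟨ sum-cong-≗ (λ j → sum-δ (colourOwner j)) ⟩
    sum {R} (λ _ → 1)                                  ≡⟨ sum-ones R ⟩
    R                                                  ∎
    where open ≡-Reasoning

  partCount-bounds : ∀ i j → indicator (colourOwner j ≟ i) * (N / R) ≤ partCount n colour j i ×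
                             partCount n colour j i ≤ indicator (colourOwner j ≟ i) * ⌈ N / R ⌉
  partCount-bounds i j with colourOwner j ≟ i | proj₂ (colour-owner n colour independent j)
  ... | no o≢i  | elsewhere rewrite elsewhere i (o≢i ∘ sym) = z≤n , z≤n
  ... | yes refl | elsewhere = subst (λ m → N / R + 0 ≤ m × m ≤ ⌈ N / R ⌉ + 0) owned
      (≤-trans (≤-reflexive (+-identityʳ _)) (lower j) , ≤-trans (upper j) (≤-reflexive (sym (+-identityʳ _))))
    where
    owned : classSize n colour j ≡ partCount n colour j (colourOwner j)
    owned = trans (classSize≡sum-partCount n colour j) (sum-supported-at _ (colourOwner j) elsewhere)

  ownedColours-bounds : ∀ i → ownedColours i * (N / R) ≤ n i × n i ≤ ownedColours i * ⌈ N / R ⌉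
  ownedColours-bounds i =
    subst₂ _≤_ (sum-*ʳ owns (N / R)) (sum-partCount n colour i) (sum-mono-≤ {R} (proj₁ ∘ partCount-bounds i)) ,
    subst₂ _≤_ (sum-partCount n colour i) (sum-*ʳ owns ⌈ N / R ⌉) (sum-mono-≤ {R} (proj₂ ∘ partCount-bounds i))
    where
    owns : Fin R → ℕ
    owns j = indicator (colourOwner j ≟ i)

  equitableColouring⇒splits : 0 < N → ∃[ e ] (suc e ≡ ⌈ N / R ⌉ × Splits n e ownedColours × sum ownedColours ≡ R)
  equitableColouring⇒splits 0<N with ⌈ N / R ⌉ in ⌈N/R⌉≡ | 0<m⇒0<⌈m/n⌉ {R} 0<N
  ... | suc e | _ = e , refl , split , sum-ownedColours
    where
    e≤N/R : e ≤ N / R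
    e≤N/R = ≤-pred (subst (_≤ suc (N / R)) ⌈N/R⌉≡ (⌈m/n⌉≤1+m/n N))
    split : Splits n e ownedColours
    split = record
      { lower = λ i → ≤-trans (*-monoʳ-≤ (ownedColours i) e≤N/R) (proj₁ (ownedColours-bounds i))
      ; upper = λ i → subst (λ h → n i ≤ ownedColours i * h) ⌈N/R⌉≡ (proj₂ (ownedColours-bounds i))
      }

hasEqCol⇒splittable : ∀ {k} {n : Fin (suc k) → ℕ} → 0 < order n → ∀ {r} → HasEqCol n r → Splittable n r
hasEqCol⇒splittable 0<N {suc r} ec = let (e , _ , split , total) = equitableColouring⇒splits ec 0<N in e , _ , split , total

-- Attainable numbers of blocks

interpolate : ∀ {k} (L U : Fin k → ℕ) → (∀ i → L i ≤ U i) → ∀ {r} → sum L ≤ r → r ≤ sum U →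
              ∃[ c ] ((∀ i → L i ≤ c i × c i ≤ U i) × sum c ≡ r)
interpolate {zero}  L U L≤U ∑L≤r r≤∑U = (λ ()) , (λ ()) , sym (n≤0⇒n≡0 r≤∑U)
interpolate {suc k} L U L≤U {r} ∑L≤r r≤∑U with r ≤? U zero + sum (L ∘ suc)
... | yes r≤U₀+∑L′ =
  let (c , L≤c≤U , ∑c≡) = interpolate (L ∘ suc) (U ∘ suc) (L≤U ∘ suc) ≤-refl (sum-mono-≤ (L≤U ∘ suc))
  in (λ { zero → c₀ ; (suc i) → c i }) , (λ { zero → L₀≤c₀ , c₀≤U₀ ; (suc i) → L≤c≤U i }) ,
     trans (cong (c₀ +_) ∑c≡) (trans (+-comm c₀ ∑L′) (m+[n∸m]≡n ∑L′≤r))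
  where
  ∑L′ = sum (L ∘ suc)
  c₀ = r ∸ ∑L′
  ∑L′≤r : ∑L′ ≤ r
  ∑L′≤r = m+n≤o⇒n≤o (L zero) ∑L≤r
  L₀≤c₀ : L zero ≤ c₀
  L₀≤c₀ = m+n≤o⇒m≤o∸n (L zero) ∑L≤r
  c₀≤U₀ : c₀ ≤ U zero
  c₀≤U₀ = m≤n+o⇒m∸n≤o r ∑L′ (subst (r ≤_) (+-comm (U zero) ∑L′) r≤U₀+∑L′)
... | no r≰U₀+∑L′ =
  let (c , L≤c≤U , ∑c≡) = interpolate (L ∘ suc) (U ∘ suc) (L≤U ∘ suc) ∑L′≤r∸U₀ (m≤n+o⇒m∸n≤o r (U zero) r≤∑U)
  in (λ { zero → U zero ; (suc i) → c i }) , (λ { zero → L≤U zero , ≤-refl ; (suc i) → L≤c≤U i }) ,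
     trans (cong (U zero +_) ∑c≡) (m+[n∸m]≡n (m+n≤o⇒m≤o (U zero) U₀+∑L′≤r))
  where
  ∑L′ = sum (L ∘ suc)
  U₀+∑L′≤r : U zero + ∑L′ ≤ r
  U₀+∑L′≤r = <⇒≤ (≰⇒> r≰U₀+∑L′)
  ∑L′≤r∸U₀ : ∑L′ ≤ r ∸ U zero
  ∑L′≤r∸U₀ = m+n≤o⇒m≤o∸n ∑L′ (subst (_≤ r) (+-comm (U zero) ∑L′) U₀+∑L′≤r)

splittable-≥order : ∀ {k} {n : Fin (suc k) → ℕ} {r} → order n ≤ r → Splittable n r
splittable-≥order {n = n} {r} N≤r =
  let (c , n≤c≤n+r , ∑c≡r) = interpolate n (λ i → n i + r) (λ i → m≤m+n (n i) r)
                               (subst (_≤ r) (order≡sum n) N≤r) (≤-trans (m≤n+m r (n zero)) (≤-sum (λ i → n i + r) zero))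
  in 0 , c , record
       { lower = λ i → subst (_≤ n i) (sym (*-zeroʳ (c i))) z≤n
       ; upper = λ i → subst (n i ≤_) (sym (*-identityʳ (c i))) (proj₁ (n≤c≤n+r i))
       } , ∑c≡r

pSum≡sum : ∀ {k} (n : Fin k → ℕ) e → pSum n (suc e) ≡ sum (λ i → ⌈ n i / suc e ⌉)
pSum≡sum {k} n e = sum-tabulate {k} _

module _ {k} {n : Fin k → ℕ} where

  splittable-between : ∀ {e U} → Splits n e U → ∀ {r} → pSum n (suc e) ≤ r → r ≤ sum U → Splittable n r
  splittable-between {e} {U} split {r} pSum≤r r≤∑U =
    let (c , L≤c≤U , ∑c≡r) = interpolate L U L≤U (subst (_≤ r) (pSum≡sum n e) pSum≤r) r≤∑U
    in e , c , record
      { lower = λ i → ≤-trans (*-monoˡ-≤ e (proj₂ (L≤c≤U i))) (Splits.lower split i)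
      ; upper = λ i → ≤-trans (m≤⌈m/n⌉*n (n i)) (*-monoˡ-≤ (suc e) (proj₁ (L≤c≤U i)))
      } , ∑c≡r
    where
    L : Fin k → ℕ
    L i = ⌈ n i / suc e ⌉
    L≤U : ∀ i → L i ≤ U i
    L≤U i = m≤o*n⇒⌈m/n⌉≤o (Splits.upper split i)

  module _ {e} (¬D : ¬ DCond n (suc e)) where

    private
      d = suc e

    ¬DCond⇒splits-floor : Splits n d (λ i → n i / d)
    ¬DCond⇒splits-floor = record
      { lower = λ i → m/n*n≤m (n i) d
      ; upper = λ i → subst (n i ≤_) (*-comm (suc d) (n i / d)) (≮⇒≥ λ lt → ¬D (inj₂ (i , lt)))
      }

    private
      ⌈⌉≤floor : ∀ i → ¬ ¬ (d ∣ n i) → ⌈ n i / d ⌉ ≤ n i / d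
      ⌈⌉≤floor i ¬¬d∣nᵢ = n∣m⇒⌈m/n⌉≤m/n (decidable-stable (d ∣? n i) ¬¬d∣nᵢ)

    -- Condition (i) failing means at most one part is not a multiple of d.
    ¬DCond⇒pSum≤1+sum-floor : pSum n d ≤ suc (sum (λ i → n i / d))
    ¬DCond⇒pSum≤1+sum-floor with any? (λ i → ¬? (d ∣? n i))
    ... | no all∣ = begin
      pSum n d                   ≡⟨ pSum≡sum n e ⟩
      sum (λ i → ⌈ n i / d ⌉)    ≤⟨ sum-mono-≤ (λ i → ⌈⌉≤floor i λ d∤nᵢ → all∣ (i , d∤nᵢ)) ⟩
      sum (λ i → n i / d)        ≤⟨ n≤1+n _ ⟩
      suc (sum (λ i → n i / d))  ∎
      where open ≤-Reasoning
    ... | yes (i₀ , d∤nᵢ₀) = begin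
      pSum n d                                          ≡⟨ pSum≡sum n e ⟩
      sum (λ i → ⌈ n i / d ⌉)                           ≤⟨ sum-mono-≤ ⌈⌉≤floor+δ ⟩
      sum (λ i → n i / d + indicator (i₀ ≟ i))          ≡⟨ ∑-distrib-+ (λ i → n i / d) (λ i → indicator (i₀ ≟ i)) ⟩
      sum (λ i → n i / d) + sum (λ i → indicator (i₀ ≟ i)) ≡⟨ cong (sum (λ i → n i / d) +_) (sum-δ i₀) ⟩
      sum (λ i → n i / d) + 1                           ≡⟨ +-comm _ 1 ⟩
      suc (sum (λ i → n i / d))                         ∎
      where
      open ≤-Reasoning
      ⌈⌉≤floor+δ : ∀ i → ⌈ n i / d ⌉ ≤ n i / d + indicator (i₀ ≟ i)
      ⌈⌉≤floor+δ i with i₀ ≟ i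
      ... | yes refl = subst (⌈ n i / d ⌉ ≤_) (+-comm 1 (n i / d)) (⌈m/n⌉≤1+m/n (n i))
      ... | no i₀≢i  = subst (⌈ n i / d ⌉ ≤_) (sym (+-identityʳ (n i / d)))
                         (⌈⌉≤floor i λ d∤nᵢ → ¬D (inj₁ (i , i₀ , i₀≢i ∘ sym , d∤nᵢ , d∤nᵢ₀)))

  -- The intervals [pSum (e + 1), sum U] for consecutive block sizes overlap as long as (i) and (ii) fail.
  splittable-range : ∀ s {e U} → (∀ t → e < t → t ≤ e + s → ¬ DCond n t) → Splits n e U →
                     ∀ {r} → pSum n (suc (e + s)) ≤ r → r ≤ sum U → Splittable n r
  splittable-range zero {e} _ split {r} pSum≤r r≤∑U =
    splittable-between split (subst (λ d → pSum n (suc d) ≤ r) (+-identityʳ e) pSum≤r) r≤∑U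
  splittable-range (suc s) {e} ¬D split {r} pSum≤r r≤∑U with pSum n (suc e) ≤? r
  ... | yes pSum≤r′ = splittable-between split pSum≤r′ r≤∑U
  ... | no pSum≰r = splittable-range s ¬D′ (¬DCond⇒splits-floor ¬D₁)
                      (subst (λ d → pSum n (suc d) ≤ r) (+-suc e s) pSum≤r) r≤∑floor
    where
    ¬D₁ : ¬ DCond n (suc e)
    ¬D₁ = ¬D (suc e) ≤-refl (m<m+n e z<s)
    ¬D′ : ∀ t → suc e < t → t ≤ suc e + s → ¬ DCond n t
    ¬D′ t e+1<t t≤ = ¬D t (<-trans (n<1+n e) e+1<t) (subst (t ≤_) (sym (+-suc e s)) t≤)
    r≤∑floor : r ≤ sum (λ i → n i / suc e)
    r≤∑floor = ≤-pred (≤-trans (≰⇒> pSum≰r) (¬DCond⇒pSum≤1+sum-floor ¬D₁))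

module _ {k} {n : Fin k → ℕ} {e c} (split : Splits n e c) where

  splits-pSum≤sum : ∀ {d} → e ≤ d → pSum n (suc d) ≤ sum c
  splits-pSum≤sum {d} e≤d = begin
    pSum n (suc d)                ≡⟨ pSum≡sum n d ⟩
    sum (λ i → ⌈ n i / suc d ⌉)   ≤⟨ sum-mono-≤ (λ i → m≤o*n⇒⌈m/n⌉≤o (≤-trans (Splits.upper split i) (*-monoʳ-≤ (c i) (s≤s e≤d)))) ⟩
    sum c                         ∎
    where open ≤-Reasoning

  module _ {D} .{{_ : NonZero D}} (D≤e : D ≤ e) where

    splits-blocks≤floor : ∀ i → c i ≤ n i / D
    splits-blocks≤floor i = o*n≤m⇒o≤m/n (≤-trans (*-monoʳ-≤ (c i) D≤e) (Splits.lower split i))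

    splits-blocks≤⌈⌉ : ∀ i → c i ≤ ⌈ n i / D ⌉
    splits-blocks≤⌈⌉ i = ≤-trans (splits-blocks≤floor i) (m/n≤⌈m/n⌉ (n i))

    splits-blocks<⌈⌉ : ∀ {i} → ¬ (D ∣ n i) → c i < ⌈ n i / D ⌉
    splits-blocks<⌈⌉ {i} D∤nᵢ = <-≤-trans (s≤s (splits-blocks≤floor i)) (n∤m⇒1+m/n≤⌈m/n⌉ D∤nᵢ)

another : ∀ {k} (i : Fin (suc (suc k))) → ∃[ j ] i ≢ j
another zero    = suc zero , λ ()
another (suc i) = zero , λ ()

-- With blocks of size at least d, two parts fall short of ⌈n_i / d⌉ blocks: under (i) the two non-multiples,
-- under (ii) the offending part and any other part (block size d itself being impossible for the offending part).
DCond⇒splits-deficit : ∀ {k} {n : Fin (suc (suc k)) → ℕ} → (∀ i → 0 < n i) → ∀ {d} → DCond n (suc d) →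
                       ∀ {e c} → Splits n e c → suc d ≤ e → sum c + 2 ≤ pSum n (suc d)
DCond⇒splits-deficit {n = n} n>0 {d} D {e} {c} split D≤e = subst (sum c + 2 ≤_) (sym (pSum≡sum n d)) (deficit D)
  where
  deficit : DCond n (suc d) → sum c + 2 ≤ sum (λ i → ⌈ n i / suc d ⌉)
  deficit (inj₁ (i , j , i≢j , D∤nᵢ , D∤nⱼ)) =
    sum-+2≤ (splits-blocks≤⌈⌉ split D≤e) i≢j (splits-blocks<⌈⌉ split D≤e D∤nᵢ) (splits-blocks<⌈⌉ split D≤e D∤nⱼ)
  deficit (inj₂ (i , over)) with m≤n⇒m<n∨m≡n D≤e
  ... | inj₂ refl = ⊥-elim (<⇒≱ over (begin
    n i                             ≤⟨ Splits.upper split i ⟩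
    c i * suc (suc d)               ≤⟨ *-monoˡ-≤ (suc (suc d)) (splits-blocks≤floor split D≤e i) ⟩
    n i / suc d * suc (suc d)       ≡⟨ *-comm (n i / suc d) _ ⟩
    suc (suc d) * (n i / suc d)     ∎))
    where open ≤-Reasoning
  ... | inj₁ D<e = sum-+2≤ (splits-blocks≤⌈⌉ split D≤e) (proj₂ (another i))
                     (splits-blocks<⌈⌉ split D≤e D∤nᵢ) (o*n<m⇒o<⌈m/n⌉ (short (proj₁ (another i))))
    where
    D∤nᵢ : ¬ (suc d ∣ n i)
    D∤nᵢ D∣nᵢ = <⇒≱ over (begin
      n i                           ≡⟨ m*[n/m]≡n D∣nᵢ ⟨
      suc d * (n i / suc d)         ≤⟨ *-monoˡ-≤ (n i / suc d) (n≤1+n (suc d)) ⟩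
      suc (suc d) * (n i / suc d)   ∎)
      where open ≤-Reasoning
    short : ∀ j → c j * suc d < n j
    short j with c j | Splits.lower split j
    ... | zero   | _      = n>0 j
    ... | suc c′ | cⱼe≤nⱼ = <-≤-trans (*-monoʳ-< (suc c′) D<e) cⱼe≤nⱼ

DCond⇒unsplittable : ∀ {k} {n : Fin (suc (suc k)) → ℕ} → (∀ i → 0 < n i) → ∀ {d} → DCond n (suc d) →
                     ∀ {r} → Splittable n r → suc r ≢ pSum n (suc d)
DCond⇒unsplittable n>0 {d} D (e , c , split , refl) 1+r≡pSum with e ≤? d
... | yes e≤d = <⇒≱ (≤-reflexive 1+r≡pSum) (splits-pSum≤sum split e≤d)
... | no e≰d  = 1+n≰n (subst (_≤ suc (sum c)) (+-comm (sum c) 2)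
                  (subst (sum c + 2 ≤_) (sym 1+r≡pSum) (DCond⇒splits-deficit n>0 D split (≰⇒> e≰d))))

-- The threshold

least-witness : {P : ℕ → Set} → (∀ t → Dec (P t)) → ∀ {b} → P b → ∃[ m ] IsMinimum P m
least-witness {P} P? {b} Pb with first-below (suc b)
  where
  first-below : ∀ b → (∃[ m ] (P m × ∀ t → t < m → ¬ P t)) ⊎ (∀ t → t < b → ¬ P t)
  first-below zero = inj₂ λ _ ()
  first-below (suc b) with first-below b | P? b
  ... | inj₁ found | _      = inj₁ found
  ... | inj₂ none  | yes Pb = inj₁ (b , Pb , none)
  ... | inj₂ none  | no ¬Pb = inj₂ λ t t<1+b → [ none t , (λ { refl → ¬Pb }) ]′ (m≤n⇒m<n∨m≡n (≤-pred t<1+b))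
... | inj₁ (m , Pm , below) = m , Pm , λ t Pt → ≮⇒≥ λ t<m → below t t<m Pt
... | inj₂ none             = ⊥-elim (none b ≤-refl Pb)

DCond? : ∀ {k} (n : Fin k → ℕ) d → Dec (DCond n d)
DCond? n zero    = no λ ()
DCond? n (suc e) =
  any? (λ i → any? λ j → ¬? (i ≟ j) ×-dec ¬? (suc e ∣? n i) ×-dec ¬? (suc e ∣? n j))
  ⊎-dec any? (λ i → suc (suc e) * (n i / suc e) <? n i)

module _ {k} {n : Fin (suc (suc k)) → ℕ} (n>0 : ∀ i → 0 < n i) where

  private
    N = order n
    n₀≤N : n zero ≤ N
    n₀≤N = subst (n zero ≤_) (sym (order≡sum n)) (≤-sum n zero)
    0<N : 0 < N
    0<N = <-≤-trans (n>0 zero) n₀≤N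

  -- d = N + 1 always qualifies, through condition (ii) for any part.
  minD-exists : ∀ q → ∃[ d ] IsMinD n q d
  minD-exists q = least-witness (λ t → ceilNq n q ≤? t ×-dec DCond? n t) (⌈N/q⌉≤1+N q , inj₂ (zero , over))
    where
    ⌈N/q⌉≤1+N : ∀ q → ceilNq n q ≤ suc N
    ⌈N/q⌉≤1+N zero    = z≤n
    ⌈N/q⌉≤1+N (suc q) = ≤-trans (m≤o*n⇒⌈m/n⌉≤o (m≤m*n N (suc q))) (n≤1+n N)
    over : suc (suc N) * (n zero / suc N) < n zero
    over = subst (_< n zero) (sym (trans (cong (suc (suc N) *_) (m<n⇒m/n≡0 (s≤s n₀≤N))) (*-zeroʳ (suc (suc N)))))
                 (n>0 zero)

  pSum-minD-isMinimum : ∀ q → HasEqCol n q → ∀ {d} → IsMinD n q d →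
                        IsMinimum (λ p′ → ∀ r → p′ ≤ r → r ≤ q → HasEqCol n r) (pSum n d)
  pSum-minD-isMinimum (suc q) ec {suc d} ((⌈N/q⌉≤d , D) , d-least)
    with equitableColouring⇒splits ec 0<N
  ... | e , 1+e≡⌈N/q⌉ , split , ∑U≡q = covers , least
    where
    e≤d : e ≤ d
    e≤d = ≤-pred (subst (_≤ suc d) (sym 1+e≡⌈N/q⌉) ⌈N/q⌉≤d)
    ¬D-between : ∀ t → e < t → t ≤ e + (d ∸ e) → ¬ DCond n t
    ¬D-between t e<t t≤ Dₜ = <⇒≱ (s≤s (subst (t ≤_) (m+[n∸m]≡n e≤d) t≤)) (d-least t (subst (_≤ t) 1+e≡⌈N/q⌉ e<t , Dₜ))
    covers : ∀ r → pSum n (suc d) ≤ r → r ≤ suc q → HasEqCol n r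
    covers r p≤r r≤q = splittable⇒hasEqCol n>0 (splittable-range (d ∸ e) ¬D-between split
      (subst (λ t → pSum n (suc t) ≤ r) (sym (m+[n∸m]≡n e≤d)) p≤r) (subst (r ≤_) (sym ∑U≡q) r≤q))
    p≤q : pSum n (suc d) ≤ suc q
    p≤q = subst (pSum n (suc d) ≤_) ∑U≡q (splits-pSum≤sum split e≤d)
    least : ∀ p′ → (∀ r → p′ ≤ r → r ≤ suc q → HasEqCol n r) → pSum n (suc d) ≤ p′
    least p′ coloured = ≮⇒≥ λ p′<p → DCond⇒unsplittable n>0 D
      (hasEqCol⇒splittable 0<N (coloured (pred p) (pred-mono-≤ p′<p) (≤-trans pred[n]≤n p≤q)))
      (suc-pred p {{>-nonZero (<-≤-trans z<s p′<p)}})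
      where p = pSum n (suc d)

  pSum-minD-isEqThreshold : ∀ {d} → IsMinD n N d → IsEqThreshold n (pSum n d)
  pSum-minD-isEqThreshold {d} minD = coloured , λ p′ coloured′ → least p′ λ r p′≤r _ → coloured′ r p′≤r
    where
    N-coloured = splittable⇒hasEqCol n>0 (splittable-≥order ≤-refl)
    up-to-N = pSum-minD-isMinimum N N-coloured minD
    least = proj₂ up-to-N
    coloured : ∀ r → pSum n d ≤ r → HasEqCol n r
    coloured r p≤r with r ≤? N
    ... | yes r≤N = proj₁ up-to-N r p≤r r≤N
    ... | no r≰N  = splittable⇒hasEqCol n>0 (splittable-≥order (<⇒≤ (≰⇒> r≰N)))

theorem1 : (k : ℕ) (n : Fin k → ℕ) → 2 ≤ k → (∀ i → 1 ≤ n i) →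
    (q : ℕ) → HasEqCol n q →
    (∃[ p ] (IsP n q p × IsMinimum (λ p′ → ∀ r → p′ ≤ r → r ≤ q → HasEqCol n r) p))
    × (∃[ t ] (IsP n (order n) t × IsEqThreshold n t))
theorem1 (suc (suc k)) n (s≤s (s≤s z≤n)) n>0 q coloured =
  let (d , minD) = minD-exists n>0 q
      (d′ , minD′) = minD-exists n>0 (order n)
  in (pSum n d , (d , minD , refl) , pSum-minD-isMinimum n>0 q coloured minD) ,
     (pSum n d′ , (d′ , minD′ , refl) , pSum-minD-isEqThreshold n>0 minD′)
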